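{- Let $G$ and $H$ be bipartite graphs, each admitting a bipartition $(A,B)$ of its vertex set into two stable sets with $|A|=n$, $|B|=m$, every vertex of $A$ of degree $b$ and every vertex of $B$ of degree $c$. Then $G\equiv H$.
   Context: Graphs are finite and simple. A hypergraph $G=(V,X)$ consists of a finite vertex set $V$ and a family $X$ of subsets of $V$; graphs are the $2$-uniform hypergraphs. If $G$ has $n$ vertices and $m\ge1$ hyperedges, its vertex-hyperedge incidence matrix $M_G\in\{0,1\}^{n\times m}$ has $(i,j)$ entry $1$ iff vertex $i$ belongs to hyperedge $j$. A doubly stochastic matrix is a square nonnegative matrix whose rows and columns each sum to $1$. For hypergraphs $G,H$, write $G\equiv H$ if either $G$ and $H$ have the same number of vertices and no hyperedges, or there exist doubly stochastic matrices $S_1,S_2$ with $S_1M_G=M_HS_2^t$ and $M_GS_2=S_1^tM_H$. -}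

module Defs where

open import Data.Nat using (ℕ; zero; suc)
open import Data.Fin using (Fin; zero; suc)
open import Data.Fin.Properties using (_≟_)
open import Data.Bool using (Bool; true; false; not; if_then_else_; _∨_)
open import Data.Product using (_×_; Σ; ∃-syntax; _,_)
open import Data.Sum using (_⊎_)
open import Data.Rational using (ℚ; 0ℚ; 1ℚ; _+_; _*_; _≤_)
open import Relation.Binary.PropositionalEquality using (_≡_; _≢_)
open import Relation.Nullary.Decidable using (⌊_⌋)

record Graph : Set where
  field
    nV : ℕ
    nE : ℕ
    u  : Fin nE → Fin nV
    v  : Fin nE → Fin nV
    loopless : ∀ e → u e ≢ v e
    simple   : ∀ e f →
      ((u e ≡ u f × v e ≡ v f) ⊎ (u e ≡ v f × v e ≡ u f)) → e ≡ f

open Graph public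

count : ∀ {k} → (Fin k → Bool) → ℕ
count {zero}  P = 0
count {suc k} P = (if P zero then 1 else 0) Data.Nat.+ count (λ i → P (suc i))

incident : (G : Graph) → Fin (nV G) → Fin (nE G) → Bool
incident G i e = ⌊ i ≟ u G e ⌋ ∨ ⌊ i ≟ v G e ⌋

degree : (G : Graph) → Fin (nV G) → ℕ
degree G i = count (incident G i)

BipartiteBiregular : Graph → ℕ → ℕ → ℕ → ℕ → Set
BipartiteBiregular G n m b c =
  Σ (Fin (nV G) → Bool) λ side →
    (count side ≡ n) ×
    (count (λ i → not (side i)) ≡ m) ×
    (∀ e → side (u G e) ≢ side (v G e)) ×
    (∀ i → side i ≡ true → degree G i ≡ b) ×
    (∀ i → side i ≡ false → degree G i ≡ c)

Mat : ℕ → ℕ → Set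
Mat p q = Fin p → Fin q → ℚ

Σℚ : ∀ {k} → (Fin k → ℚ) → ℚ
Σℚ {zero}  f = 0ℚ
Σℚ {suc k} f = f zero + Σℚ (λ i → f (suc i))

_·_ : ∀ {p q r} → Mat p q → Mat q r → Mat p r
(A · B) i j = Σℚ (λ k → A i k * B k j)

_ᵗ : ∀ {p q} → Mat p q → Mat q p
(A ᵗ) i j = A j i

toℚ : Bool → ℚ
toℚ true  = 1ℚ
toℚ false = 0ℚ

incMat : (G : Graph) → Mat (nV G) (nE G)
incMat G i e = toℚ (incident G i e)

DoublyStochastic : ∀ {p q} → Mat p q → Set
DoublyStochastic {p} {q} S =
  (p ≡ q) ×
  (∀ i j → 0ℚ ≤ S i j) ×
  (∀ i → Σℚ (λ j → S i j) ≡ 1ℚ) ×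
  (∀ j → Σℚ (λ i → S i j) ≡ 1ℚ)

_≋_ : Graph → Graph → Set
G ≋ H =
  (nV G ≡ nV H × nE G ≡ 0 × nE H ≡ 0) ⊎
  (∃[ S₁ ] ∃[ S₂ ]
     (DoublyStochastic {nV H} {nV G} S₁ × DoublyStochastic {nE G} {nE H} S₂ ×
      (∀ i j → (S₁ · incMat G) i j ≡ (incMat H · (S₂ ᵗ)) i j) ×
      (∀ i j → (incMat G · S₂) i j ≡ ((S₁ ᵗ) · incMat H) i j)))

-- Double counting gives |E| = n b = m c, so G and H have equally many edges. Take S₂ = J/|E|,
-- and let S₁ relate vertex i of H to vertex j of G with weight b/|E| = 1/n if both lie in A,
-- c/|E| = 1/m if both lie in B, and 0 otherwise; S₁ is doubly stochastic because |A| = n and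
-- |B| = m. Since every edge has exactly one end on each side, (S₁ M_G)(i,e) is the weight of
-- the side of i, which is deg(i)/|E| = (M_H S₂ᵗ)(i,e); the second identity is symmetric.
-- Without edges the first alternative of the relation holds.
module Submission where

open import Defs
open import Data.Nat as ℕ using (ℕ; zero; suc)
open import Data.Nat.Properties as ℕ using (+-suc)
open import Data.Fin using (Fin; zero; suc)
open import Data.Fin.Properties using (_≟_)
open import Data.Bool using (Bool; true; false; not; if_then_else_)
open import Data.Product using (_,_)
open import Data.Sum using (inj₁; inj₂)
open import Data.Empty using (⊥-elim)
open import Data.Rational using (ℚ; 0ℚ; 1ℚ; _+_; _*_; _≤_; 1/_; Positive; NonNegative; NonZero)
import Data.Rational.Properties as ℚ
open import Algebra.Bundles using (Ring; CommutativeMonoid)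
open import Algebra.Properties.Semiring.Mult (Ring.semiring ℚ.+-*-ring) using (_×_; ×-assoc-*; ×1-homo-*)
open import Algebra.Properties.Group ℚ.+-0-group using (∙-cancelˡ)
open import Algebra.Properties.CommutativeSemigroup (CommutativeMonoid.commutativeSemigroup ℚ.+-0-commutativeMonoid)
  using () renaming (interchange to +-interchange)
open import Relation.Binary.PropositionalEquality
open import Function using (_∘_)
open import Relation.Nullary.Decidable using (⌊_⌋; yes; no)

ι : ℕ → ℚ
ι k = k × 1ℚ

ι-nonNegative : ∀ k → NonNegative (ι k)
ι-nonNegative zero    = _
ι-nonNegative (suc k) = ℚ.nonNeg+nonNeg⇒nonNeg 1ℚ (ι k) {{ι-nonNegative k}}

ι-positive : ∀ k .{{_ : ℕ.NonZero k}} → Positive (ι k)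
ι-positive (suc k) = ℚ.pos+nonNeg⇒pos 1ℚ (ι k) {{ι-nonNegative k}}

ι-suc≢0 : ∀ k → ι (suc k) ≢ 0ℚ
ι-suc≢0 k eq = ℚ.<-irrefl (sym eq) (ℚ.positive⁻¹ (ι (suc k)) {{ι-positive (suc k)}})

ι-injective : ∀ {a b} → ι a ≡ ι b → a ≡ b
ι-injective {zero}  {zero}  _  = refl
ι-injective {zero}  {suc b} eq = ⊥-elim (ι-suc≢0 b (sym eq))
ι-injective {suc a} {zero}  eq = ⊥-elim (ι-suc≢0 a eq)
ι-injective {suc a} {suc b} eq = cong suc (ι-injective (∙-cancelˡ 1ℚ (ι a) (ι b) eq))

toℚ-nonNegative : ∀ x → NonNegative (toℚ x)
toℚ-nonNegative true  = _
toℚ-nonNegative false = _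

Σℚ-cong : ∀ {k} {f g : Fin k → ℚ} → (∀ i → f i ≡ g i) → Σℚ f ≡ Σℚ g
Σℚ-cong {zero}  f≗g = refl
Σℚ-cong {suc k} f≗g = cong₂ _+_ (f≗g zero) (Σℚ-cong (λ i → f≗g (suc i)))

Σℚ-distrib-+ : ∀ {k} (f g : Fin k → ℚ) → Σℚ (λ i → f i + g i) ≡ Σℚ f + Σℚ g
Σℚ-distrib-+ {zero}  f g = sym (ℚ.+-identityˡ 0ℚ)
Σℚ-distrib-+ {suc k} f g = trans
  (cong (f zero + g zero +_) (Σℚ-distrib-+ (λ i → f (suc i)) (λ i → g (suc i))))
  (+-interchange (f zero) (g zero) (Σℚ (λ i → f (suc i))) (Σℚ (λ i → g (suc i))))

Σℚ-*ʳ : ∀ {k} (f : Fin k → ℚ) x → Σℚ (λ i → f i * x) ≡ Σℚ f * x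
Σℚ-*ʳ {zero}  f x = sym (ℚ.*-zeroˡ x)
Σℚ-*ʳ {suc k} f x = trans (cong (f zero * x +_) (Σℚ-*ʳ (λ i → f (suc i)) x))
  (sym (ℚ.*-distribʳ-+ x (f zero) (Σℚ (λ i → f (suc i)))))

Σℚ-*ˡ : ∀ {k} x (f : Fin k → ℚ) → Σℚ (λ i → x * f i) ≡ x * Σℚ f
Σℚ-*ˡ x f = trans (Σℚ-cong (λ i → ℚ.*-comm x (f i))) (trans (Σℚ-*ʳ f x) (ℚ.*-comm (Σℚ f) x))

Σℚ-replicate : ∀ k x → Σℚ {k} (λ _ → x) ≡ k × x
Σℚ-replicate zero    x = refl
Σℚ-replicate (suc k) x = cong (x +_) (Σℚ-replicate k x)

Σℚ-const : ∀ k x → Σℚ {k} (λ _ → x) ≡ ι k * x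
Σℚ-const k x = trans (Σℚ-replicate k x)
  (trans (cong (k ×_) (sym (ℚ.*-identityˡ x))) (sym (×-assoc-* k 1ℚ x)))

Σℚ-zero : ∀ k → Σℚ {k} (λ _ → 0ℚ) ≡ 0ℚ
Σℚ-zero k = trans (Σℚ-const k 0ℚ) (ℚ.*-zeroʳ (ι k))

Σℚ-comm : ∀ {k l} (f : Fin k → Fin l → ℚ) →
  Σℚ (λ i → Σℚ (λ j → f i j)) ≡ Σℚ (λ j → Σℚ (λ i → f i j))
Σℚ-comm {zero}  {l} f = sym (Σℚ-zero l)
Σℚ-comm {suc k} f = trans (cong (Σℚ (f zero) +_) (Σℚ-comm (λ i → f (suc i))))
  (sym (Σℚ-distrib-+ (f zero) (λ j → Σℚ (λ i → f (suc i) j))))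

Σℚ-count : ∀ {k} (P : Fin k → Bool) → Σℚ (λ i → toℚ (P i)) ≡ ι (count P)
Σℚ-count {zero}  P = refl
Σℚ-count {suc k} P with P zero
... | true  = cong (1ℚ +_) (Σℚ-count (λ i → P (suc i)))
... | false = trans (ℚ.+-identityˡ _) (Σℚ-count (λ i → P (suc i)))

Σℚ-indicator : ∀ {k} (h : Fin k → ℚ) a → Σℚ (λ i → h i * toℚ ⌊ i ≟ a ⌋) ≡ h a
Σℚ-indicator {suc k} h zero = begin
  h zero * 1ℚ + Σℚ (λ i → h (suc i) * 0ℚ)
    ≡⟨ cong₂ _+_ (ℚ.*-identityʳ (h zero)) (Σℚ-cong (λ i → ℚ.*-zeroʳ (h (suc i)))) ⟩
  h zero + Σℚ {k} (λ _ → 0ℚ)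
    ≡⟨ cong (h zero +_) (Σℚ-zero k) ⟩
  h zero + 0ℚ
    ≡⟨ ℚ.+-identityʳ (h zero) ⟩
  h zero ∎
  where open ≡-Reasoning
Σℚ-indicator {suc k} h (suc a) =
  trans (cong₂ _+_ (ℚ.*-zeroʳ (h zero)) (Σℚ-cong (λ i → cong (λ d → h (suc i) * toℚ d) (suc-≟ i a))))
        (trans (ℚ.+-identityˡ _) (Σℚ-indicator (λ i → h (suc i)) a))
  where
  suc-≟ : ∀ {k} (i j : Fin k) → ⌊ suc i ≟ suc j ⌋ ≡ ⌊ i ≟ j ⌋
  suc-≟ i j with i ≟ j
  ... | yes _ = refl
  ... | no  _ = refl

incMat-split : (G : Graph) (j : Fin (nV G)) (e : Fin (nE G)) →
  incMat G j e ≡ toℚ ⌊ j ≟ u G e ⌋ + toℚ ⌊ j ≟ v G e ⌋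
incMat-split G j e with j ≟ u G e | j ≟ v G e
... | yes j≡u | yes j≡v = ⊥-elim (loopless G e (trans (sym j≡u) j≡v))
... | yes _   | no  _   = refl
... | no  _   | yes _   = refl
... | no  _   | no  _   = refl

incMat-column : (G : Graph) (h : Fin (nV G) → ℚ) (e : Fin (nE G)) →
  Σℚ (λ j → h j * incMat G j e) ≡ h (u G e) + h (v G e)
incMat-column G h e = begin
  Σℚ (λ j → h j * incMat G j e)
    ≡⟨ Σℚ-cong (λ j → trans (cong (h j *_) (incMat-split G j e)) (ℚ.*-distribˡ-+ (h j) _ _)) ⟩
  Σℚ (λ j → h j * toℚ ⌊ j ≟ u G e ⌋ + h j * toℚ ⌊ j ≟ v G e ⌋)
    ≡⟨ Σℚ-distrib-+ (λ j → h j * toℚ ⌊ j ≟ u G e ⌋) (λ j → h j * toℚ ⌊ j ≟ v G e ⌋) ⟩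
  Σℚ (λ j → h j * toℚ ⌊ j ≟ u G e ⌋) + Σℚ (λ j → h j * toℚ ⌊ j ≟ v G e ⌋)
    ≡⟨ cong₂ _+_ (Σℚ-indicator h (u G e)) (Σℚ-indicator h (v G e)) ⟩
  h (u G e) + h (v G e) ∎
  where open ≡-Reasoning

incMat-row : (G : Graph) (j : Fin (nV G)) → Σℚ (incMat G j) ≡ ι (degree G j)
incMat-row G j = Σℚ-count (incident G j)

count-+-count-not : ∀ {k} (P : Fin k → Bool) → count P ℕ.+ count (λ i → not (P i)) ≡ k
count-+-count-not {zero}  P = refl
count-+-count-not {suc k} P with P zero
... | true  = cong suc (count-+-count-not (λ i → P (suc i)))
... | false = trans (+-suc (count (λ i → P (suc i))) _) (cong suc (count-+-count-not (λ i → P (suc i))))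

onSide : Bool → Bool → Bool
onSide true  x = x
onSide false x = not x

onSide-edge : ∀ t {x y} → x ≢ y → toℚ (onSide t x) + toℚ (onSide t y) ≡ 1ℚ
onSide-edge t     {true}  {true}  x≢y = ⊥-elim (x≢y refl)
onSide-edge t     {false} {false} x≢y = ⊥-elim (x≢y refl)
onSide-edge true  {true}  {false} _   = refl
onSide-edge true  {false} {true}  _   = refl
onSide-edge false {true}  {false} _   = refl
onSide-edge false {false} {true}  _   = refl

onSide-select : ∀ (f : Bool → ℚ) t x → toℚ (onSide t x) * f x ≡ toℚ (onSide t x) * f t
onSide-select f true  true  = refl
onSide-select f true  false = trans (ℚ.*-zeroˡ (f false)) (sym (ℚ.*-zeroˡ (f true)))
onSide-select f false true  = trans (ℚ.*-zeroˡ (f true)) (sym (ℚ.*-zeroˡ (f false)))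
onSide-select f false false = refl

onSide-swap : ∀ (f : Bool → ℚ) t x → toℚ (onSide t x) * f t ≡ toℚ (onSide x t) * f x
onSide-swap f true  true  = refl
onSide-swap f true  false = trans (ℚ.*-zeroˡ (f true)) (sym (ℚ.*-zeroˡ (f false)))
onSide-swap f false true  = trans (ℚ.*-zeroˡ (f false)) (sym (ℚ.*-zeroˡ (f true)))
onSide-swap f false false = refl

Σℚ-onSide : ∀ {k} (s : Fin k → Bool) t x →
  Σℚ (λ j → toℚ (onSide t (s j)) * x) ≡ ι (count (λ j → onSide t (s j))) * x
Σℚ-onSide s t x =
  trans (Σℚ-*ʳ (λ j → toℚ (onSide t (s j))) x) (cong (_* x) (Σℚ-count (λ j → onSide t (s j))))

record Biregular (G : Graph) (size deg : Bool → ℕ) : Set where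
  field
    side        : Fin (nV G) → Bool
    proper      : ∀ e → side (u G e) ≢ side (v G e)
    count-side  : ∀ t → count (λ j → onSide t (side j)) ≡ size t
    degree-side : ∀ j → degree G j ≡ deg (side j)

  nV≡size+size : nV G ≡ size true ℕ.+ size false
  nV≡size+size = trans (sym (count-+-count-not side)) (cong₂ ℕ._+_ (count-side true) (count-side false))

  -- Double counting the incident pairs (j, e) with j on side t.
  ι-nE≡size*deg : ∀ t → ι (nE G) ≡ ι (size t) * ι (deg t)
  ι-nE≡size*deg t = begin
    ι (nE G)                                   ≡⟨ sym (Σℚ-replicate (nE G) 1ℚ) ⟩
    Σℚ {nE G} (λ _ → 1ℚ)                       ≡⟨ Σℚ-cong (λ e → sym (onSide-edge t (proper e))) ⟩
    Σℚ (λ e → h (u G e) + h (v G e))           ≡⟨ Σℚ-cong (λ e → sym (incMat-column G h e)) ⟩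
    Σℚ (λ e → Σℚ (λ j → h j * incMat G j e))   ≡⟨ Σℚ-comm (λ e j → h j * incMat G j e) ⟩
    Σℚ (λ j → Σℚ (λ e → h j * incMat G j e))   ≡⟨ Σℚ-cong (λ j → Σℚ-*ˡ (h j) (incMat G j)) ⟩
    Σℚ (λ j → h j * Σℚ (incMat G j))           ≡⟨ Σℚ-cong (λ j → cong (h j *_) (incMat-row G j)) ⟩
    Σℚ (λ j → h j * ι (degree G j))            ≡⟨ Σℚ-cong (λ j → cong (λ d → h j * ι d) (degree-side j)) ⟩
    Σℚ (λ j → h j * ι (deg (side j)))          ≡⟨ Σℚ-cong (λ j → onSide-select (ι ∘ deg) t (side j)) ⟩
    Σℚ (λ j → h j * ι (deg t))                 ≡⟨ Σℚ-onSide side t (ι (deg t)) ⟩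
    ι (count (λ j → onSide t (side j))) * ι (deg t) ≡⟨ cong (λ n → ι n * ι (deg t)) (count-side t) ⟩
    ι (size t) * ι (deg t) ∎
    where
    open ≡-Reasoning
    h : Fin (nV G) → ℚ
    h j = toℚ (onSide t (side j))

  nE≡size*deg : ∀ t → nE G ≡ size t ℕ.* deg t
  nE≡size*deg t = ι-injective (trans (ι-nE≡size*deg t) (sym (×1-homo-* (size t) (deg t))))

fromBipartiteBiregular : ∀ G {n m b c} → BipartiteBiregular G n m b c →
  Biregular G (λ t → if t then n else m) (λ t → if t then b else c)
fromBipartiteBiregular G {n} {m} {b} {c} (side , count-A , count-B , proper , degree-A , degree-B) =
  record { side = side ; proper = proper ; count-side = count-side ; degree-side = degree-side }
  where
  count-side : ∀ t → count (λ j → onSide t (side j)) ≡ (if t then n else m)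
  count-side true  = count-A
  count-side false = count-B

  degree-side : ∀ j → degree G j ≡ (if side j then b else c)
  degree-side j with side j in side-j
  ... | true  = degree-A j side-j
  ... | false = degree-B j side-j

module Similarity {G H : Graph} {size deg : Bool → ℕ}
  (BG : Biregular G size deg) (BH : Biregular H size deg) where

  open Biregular

  nV≡nV : nV G ≡ nV H
  nV≡nV = trans (nV≡size+size BG) (sym (nV≡size+size BH))

  nE≡nE : nE G ≡ nE H
  nE≡nE = trans (nE≡size*deg BG true) (sym (nE≡size*deg BH true))

  module Witness .{{_ : ℕ.NonZero (nE G)}} where

    instance
      ιE-positive : Positive (ι (nE G))
      ιE-positive = ι-positive (nE G)

      ιE-nonZero : NonZero (ι (nE G))
      ιE-nonZero = ℚ.pos⇒nonZero (ι (nE G))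

    1/E : ℚ
    1/E = 1/ ι (nE G)

    1/E-nonNegative : NonNegative 1/E
    1/E-nonNegative = ℚ.pos⇒nonNeg 1/E {{ℚ.1/pos⇒pos (ι (nE G))}}

    weight : Bool → ℚ
    weight t = ι (deg t) * 1/E

    weight-nonNegative : ∀ t → NonNegative (weight t)
    weight-nonNegative t = ℚ.nonNeg*nonNeg⇒nonNeg (ι (deg t)) {{ι-nonNegative (deg t)}} 1/E {{1/E-nonNegative}}

    size*weight≡1 : ∀ t → ι (size t) * weight t ≡ 1ℚ
    size*weight≡1 t = begin
      ι (size t) * (ι (deg t) * 1/E)  ≡⟨ sym (ℚ.*-assoc (ι (size t)) (ι (deg t)) 1/E) ⟩
      (ι (size t) * ι (deg t)) * 1/E  ≡⟨ cong (_* 1/E) (sym (ι-nE≡size*deg BG t)) ⟩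
      ι (nE G) * 1/E                  ≡⟨ ℚ.*-inverseʳ (ι (nE G)) ⟩
      1ℚ ∎
      where open ≡-Reasoning

    Σℚ-incMat-1/E : ∀ {K} (BK : Biregular K size deg) j →
      Σℚ (λ f → incMat K j f * 1/E) ≡ weight (side BK j)
    Σℚ-incMat-1/E {K} BK j = trans (Σℚ-*ʳ (incMat K j) 1/E)
      (cong (_* 1/E) (trans (incMat-row K j) (cong ι (degree-side BK j))))

    entry : Bool → Bool → ℚ
    entry t x = toℚ (onSide t x) * weight t

    entry-nonNegative : ∀ t x → 0ℚ ≤ entry t x
    entry-nonNegative t x = ℚ.nonNegative⁻¹ (entry t x)
      {{ℚ.nonNeg*nonNeg⇒nonNeg (toℚ (onSide t x)) {{toℚ-nonNegative (onSide t x)}} (weight t) {{weight-nonNegative t}}}}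

    entry-swap : ∀ t x → entry t x ≡ entry x t
    entry-swap = onSide-swap weight

    entry-edge : ∀ t {x y} → x ≢ y → entry t x + entry t y ≡ weight t
    entry-edge t {x} {y} x≢y = trans (sym (ℚ.*-distribʳ-+ (weight t) (toℚ (onSide t x)) (toℚ (onSide t y))))
      (trans (cong (_* weight t) (onSide-edge t x≢y)) (ℚ.*-identityˡ (weight t)))

    Σℚ-entry : ∀ {K} (BK : Biregular K size deg) t → Σℚ (λ j → entry t (side BK j)) ≡ 1ℚ
    Σℚ-entry BK t = trans (Σℚ-onSide (side BK) t (weight t))
      (trans (cong (λ n → ι n * weight t) (count-side BK t)) (size*weight≡1 t))

    S₁ : Mat (nV H) (nV G)
    S₁ i j = entry (side BH i) (side BG j)

    S₂ : Mat (nE G) (nE H)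
    S₂ _ _ = 1/E

    S₁-doublyStochastic : DoublyStochastic S₁
    S₁-doublyStochastic =
        sym nV≡nV
      , (λ i j → entry-nonNegative (side BH i) (side BG j))
      , (λ i → Σℚ-entry BG (side BH i))
      , (λ j → trans (Σℚ-cong (λ i → entry-swap (side BH i) (side BG j))) (Σℚ-entry BH (side BG j)))

    S₂-doublyStochastic : DoublyStochastic S₂
    S₂-doublyStochastic =
        nE≡nE
      , (λ _ _ → ℚ.nonNegative⁻¹ 1/E {{1/E-nonNegative}})
      , (λ _ → trans (Σℚ-const (nE H) 1/E) (trans (cong (λ n → ι n * 1/E) (sym nE≡nE)) (ℚ.*-inverseʳ (ι (nE G)))))
      , (λ _ → trans (Σℚ-const (nE G) 1/E) (ℚ.*-inverseʳ (ι (nE G))))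

    S₁-intertwines : ∀ i e → (S₁ · incMat G) i e ≡ (incMat H · (S₂ ᵗ)) i e
    S₁-intertwines i e = begin
      Σℚ (λ j → S₁ i j * incMat G j e)                  ≡⟨ incMat-column G (S₁ i) e ⟩
      S₁ i (u G e) + S₁ i (v G e)                       ≡⟨ entry-edge (side BH i) (proper BG e) ⟩
      weight (side BH i)                                ≡⟨ sym (Σℚ-incMat-1/E BH i) ⟩
      Σℚ (λ f → incMat H i f * 1/E) ∎
      where open ≡-Reasoning

    S₂-intertwines : ∀ j f → (incMat G · S₂) j f ≡ ((S₁ ᵗ) · incMat H) j f
    S₂-intertwines j f = begin
      Σℚ (λ e → incMat G j e * 1/E)                     ≡⟨ Σℚ-incMat-1/E BG j ⟩
      weight (side BG j)                                ≡⟨ sym (entry-edge (side BG j) (proper BH f)) ⟩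
      entry (side BG j) (side BH (u H f)) + entry (side BG j) (side BH (v H f))
        ≡⟨ cong₂ _+_ (entry-swap (side BG j) _) (entry-swap (side BG j) _) ⟩
      S₁ (u H f) j + S₁ (v H f) j                       ≡⟨ sym (incMat-column H (λ i → S₁ i j) f) ⟩
      Σℚ (λ i → S₁ i j * incMat H i f) ∎
      where open ≡-Reasoning

  similar : G ≋ H
  similar with nE G ℕ.≟ 0
  ... | yes nE≡0 = inj₁ (nV≡nV , nE≡0 , trans (sym nE≡nE) nE≡0)
  ... | no  nE≢0 = inj₂ (S₁ , S₂ , S₁-doublyStochastic , S₂-doublyStochastic , S₁-intertwines , S₂-intertwines)
    where open Witness {{ℕ.≢-nonZero nE≢0}}

mainTheorem5 : (n m b c : ℕ) (G H : Graph) →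
    BipartiteBiregular G n m b c → BipartiteBiregular H n m b c → G ≋ H
mainTheorem5 n m b c G H bG bH =
  Similarity.similar (fromBipartiteBiregular G bG) (fromBipartiteBiregular H bH)
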